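{- The logic $LET_F^+$ (with the constants $\top,\bot$) coincides with the logic preserving degrees of truth of the variety of involutive Stone algebras presented in the signature $\{\land,\lor,\neg,\circ,\bot,\top\}$; that is, for every set of formulas $\Gamma\cup\{A\}$ over this signature, $\Gamma\vdash_{LET_F^+}A$ iff $\Gamma\models^{\le}_{\mathbb{S}_6}A$.
   Context: Formulas are built from a denumerable set of propositional variables over $\{\land,\lor,\neg,\circ,\bot,\top\}$. $LET_F^+$ is the natural deduction system with rules: ($\land$I) from $A,B$ infer $A\land B$; ($\land$E) from $A\land B$ infer $A$ and $B$; ($\lor$I) from $A$ (or $B$) infer $A\lor B$; ($\lor$E) from $A\lor B$ and derivations of $C$ from $[A]$ and from $[B]$ infer $C$ (discharging); ($\neg\land$I) from $\neg A$ (or $\neg B$) infer $\neg(A\land B)$; ($\neg\land$E) from $\neg(A\land B)$ and derivations of $C$ from $[\neg A]$ and from $[\neg B]$ infer $C$; ($\neg\lor$I) from $\neg A,\neg B$ infer $\neg(A\lor B)$; ($\neg\lor$E) from $\neg(A\lor B)$ infer $\neg A$ and $\neg B$; (DN) $A$ and $\neg\neg A$ inter-derivable; (EXP$^\circ$) from $\circ A,A,\neg A$ infer $B$; (PEM$^\circ$) from $\circ A$ infer $A\lor\neg A$; and, writing $A^T$ for $\circ A\land A$ and $A^F$ for $\circ A\land\neg A$: (I$\circ$) axiom $\circ\circ A$; (I$\neg\circ$) from $\circ A$ infer $\circ\neg A$; (E$\neg\circ$) from $\circ\neg A$ infer $\circ A$; (I$\land$T) from $A^T,B^T$ infer $(A\land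 B)^T$; (I$\land$F) from $A^F$ (or $B^F$) infer $(A\land B)^F$; (I$\lor$T) from $A^T$ (or $B^T$) infer $(A\lor B)^T$; (I$\lor$F) from $A^F,B^F$ infer $(A\lor B)^F$; (E$\land$T) from $(A\land B)^T$ infer $A^T$ and $B^T$; (E$\land$F) from $(A\land B)^F$ and derivations of $C$ from $[A^F]$ and from $[B^F]$ infer $C$; (E$\lor$T) from $(A\lor B)^T$ and derivations of $C$ from $[A^T]$ and from $[B^T]$ infer $C$; (E$\lor$F) from $(A\lor B)^F$ infer $A^F$ and $B^F$. Here $LET_F^+$ is regarded as expanded with the constants $\top$ and $\bot$, which are definable in it (e.g. $\top$ as $\circ p\lor\neg\circ p$ and $\bot$ as $\neg\top$ for a fixed variable $p$). An involutive Stone algebra (ISA) is a De Morgan algebra $\langle L,\land,\lor,\neg,\bot,\top\rangle$ expanded with a unary operator $\nabla$ such that $\nabla\bot=\bot$, $x\le\nabla x$, $\nabla(x\land y)=\nabla x\land\nabla y$ and $\nabla x\land\neg\nabla x=\bot$ (Cignoli–de Gallego). The variety of ISAs is generated by the six-element ISA $\mathbb{S}_6$, whose universe is $\{F,F_0,\mathsf{n},\mathsf{b},T_0,T\}$ with lattice order $F<F_0<\mathsf{n},\mathsf{b}<T_0<T$ ($\mathsf{n}$ and $\mathsf{b}$ incomparable), $\land,\lor$ meet and join, $\bot=F$, $\top=T$, $\neg T=F,\neg F=T,\neg T_0=F_0,\neg F_0=T_0,\neg\mathsf{n}=\mathsf{n},\neg\mathsf{b}=\mathsf{b}$, and $\nabla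 a=T$ for $a\ne F$, $\nabla F=F$. ISAs are presented in the signature with $\circ$ by setting $\circ x=\neg\nabla x\lor\neg\nabla\neg x$ (so in $\mathbb{S}_6$, $\circ a=T$ if $a\in\{T,F\}$ and $\circ a=F$ otherwise); conversely $\nabla x=x\lor\neg\circ x$. The degree-preserving logic: $\Gamma\models^{\le}_{\mathbb{S}_6}A$ iff either $v(A)=T$ for every valuation (homomorphism) $v$ into $\mathbb{S}_6$, or there are $A_1,\dots,A_n\in\Gamma$ ($n\ge1$) with $v(A_1)\land\dots\land v(A_n)\le v(A)$ for every valuation $v$ into $\mathbb{S}_6$; since $\mathbb{S}_6$ generates the variety, this is the logic preserving degrees of truth of the variety of ISAs. -}

module Defs where

open import Data.Nat using (ℕ)
open import Data.Bool using (Bool; true; false; if_then_else_)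
open import Data.List using (List; []; _∷_)
open import Data.List.Relation.Unary.All using (All)
open import Data.Product using (Σ; _×_; _,_)
open import Data.Sum using (_⊎_)
open import Relation.Binary.PropositionalEquality using (_≡_)

infixr 6 _∧′_
infixr 5 _∨′_
infix 8 ¬′_ ∘′_
infix 9 _ᵀ _ᶠ

data Formula : Set where
  var  : ℕ → Formula
  _∧′_ : Formula → Formula → Formula
  _∨′_ : Formula → Formula → Formula
  ¬′_  : Formula → Formula
  ∘′_  : Formula → Formula
  ⊥′   : Formula
  ⊤′   : Formula

_ᵀ : Formula → Formula
A ᵀ = (∘′ A) ∧′ A

_ᶠ : Formula → Formula
A ᶠ = (∘′ A) ∧′ (¬′ A)

FSet : Set₁
FSet = Formula → Set

infixl 4 _,,_
_,,_ : FSet → Formula → FSet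
(Γ ,, A) X = Γ X ⊎ X ≡ A

infix 3 _⊢_

data _⊢_ : FSet → Formula → Set₁ where
  hyp   : ∀ {Γ A} → Γ A → Γ ⊢ A
  ∧I    : ∀ {Γ A B} → Γ ⊢ A → Γ ⊢ B → Γ ⊢ A ∧′ B
  ∧E₁   : ∀ {Γ A B} → Γ ⊢ A ∧′ B → Γ ⊢ A
  ∧E₂   : ∀ {Γ A B} → Γ ⊢ A ∧′ B → Γ ⊢ B
  ∨I₁   : ∀ {Γ A B} → Γ ⊢ A → Γ ⊢ A ∨′ B
  ∨I₂   : ∀ {Γ A B} → Γ ⊢ B → Γ ⊢ A ∨′ B
  ∨E    : ∀ {Γ A B C} → Γ ⊢ A ∨′ B → (Γ ,, A) ⊢ C → (Γ ,, B) ⊢ C → Γ ⊢ C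
  ¬∧I₁  : ∀ {Γ A B} → Γ ⊢ ¬′ A → Γ ⊢ ¬′ (A ∧′ B)
  ¬∧I₂  : ∀ {Γ A B} → Γ ⊢ ¬′ B → Γ ⊢ ¬′ (A ∧′ B)
  ¬∧E   : ∀ {Γ A B C} → Γ ⊢ ¬′ (A ∧′ B) → (Γ ,, ¬′ A) ⊢ C → (Γ ,, ¬′ B) ⊢ C → Γ ⊢ C
  ¬∨I   : ∀ {Γ A B} → Γ ⊢ ¬′ A → Γ ⊢ ¬′ B → Γ ⊢ ¬′ (A ∨′ B)
  ¬∨E₁  : ∀ {Γ A B} → Γ ⊢ ¬′ (A ∨′ B) → Γ ⊢ ¬′ A
  ¬∨E₂  : ∀ {Γ A B} → Γ ⊢ ¬′ (A ∨′ B) → Γ ⊢ ¬′ B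
  DNI   : ∀ {Γ A} → Γ ⊢ A → Γ ⊢ ¬′ ¬′ A
  DNE   : ∀ {Γ A} → Γ ⊢ ¬′ ¬′ A → Γ ⊢ A
  EXP∘  : ∀ {Γ A B} → Γ ⊢ ∘′ A → Γ ⊢ A → Γ ⊢ ¬′ A → Γ ⊢ B
  PEM∘  : ∀ {Γ A} → Γ ⊢ ∘′ A → Γ ⊢ A ∨′ ¬′ A
  I∘    : ∀ {Γ A} → Γ ⊢ ∘′ ∘′ A
  I¬∘   : ∀ {Γ A} → Γ ⊢ ∘′ A → Γ ⊢ ∘′ ¬′ A
  E¬∘   : ∀ {Γ A} → Γ ⊢ ∘′ ¬′ A → Γ ⊢ ∘′ A
  I∧T   : ∀ {Γ A B} → Γ ⊢ A ᵀ → Γ ⊢ B ᵀ → Γ ⊢ (A ∧′ B) ᵀ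
  I∧F₁  : ∀ {Γ A B} → Γ ⊢ A ᶠ → Γ ⊢ (A ∧′ B) ᶠ
  I∧F₂  : ∀ {Γ A B} → Γ ⊢ B ᶠ → Γ ⊢ (A ∧′ B) ᶠ
  I∨T₁  : ∀ {Γ A B} → Γ ⊢ A ᵀ → Γ ⊢ (A ∨′ B) ᵀ
  I∨T₂  : ∀ {Γ A B} → Γ ⊢ B ᵀ → Γ ⊢ (A ∨′ B) ᵀ
  I∨F   : ∀ {Γ A B} → Γ ⊢ A ᶠ → Γ ⊢ B ᶠ → Γ ⊢ (A ∨′ B) ᶠ
  E∧T₁  : ∀ {Γ A B} → Γ ⊢ (A ∧′ B) ᵀ → Γ ⊢ A ᵀ
  E∧T₂  : ∀ {Γ A B} → Γ ⊢ (A ∧′ B) ᵀ → Γ ⊢ B ᵀ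
  E∧F   : ∀ {Γ A B C} → Γ ⊢ (A ∧′ B) ᶠ → (Γ ,, A ᶠ) ⊢ C → (Γ ,, B ᶠ) ⊢ C → Γ ⊢ C
  E∨T   : ∀ {Γ A B C} → Γ ⊢ (A ∨′ B) ᵀ → (Γ ,, A ᵀ) ⊢ C → (Γ ,, B ᵀ) ⊢ C → Γ ⊢ C
  E∨F₁  : ∀ {Γ A B} → Γ ⊢ (A ∨′ B) ᶠ → Γ ⊢ A ᶠ
  E∨F₂  : ∀ {Γ A B} → Γ ⊢ (A ∨′ B) ᶠ → Γ ⊢ B ᶠ

p₀ : Formula
p₀ = var 0

⊤def : Formula
⊤def = (∘′ p₀) ∨′ (¬′ (∘′ p₀))

⊥def : Formula
⊥def = ¬′ ⊤def

unfold : Formula → Formula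
unfold (var n)   = var n
unfold (A ∧′ B)  = unfold A ∧′ unfold B
unfold (A ∨′ B)  = unfold A ∨′ unfold B
unfold (¬′ A)    = ¬′ unfold A
unfold (∘′ A)    = ∘′ unfold A
unfold ⊥′        = ⊥def
unfold ⊤′        = ⊤def

infix 3 _⊢LETF⁺_
_⊢LETF⁺_ : FSet → Formula → Set₁
Γ ⊢LETF⁺ A = (λ X → Σ Formula λ B → Γ B × unfold B ≡ X) ⊢ unfold A

data S6 : Set where
  F F₀ n b T₀ T : S6

-- lattice order F < F₀ < n , b < T₀ < T  (n, b incomparable)
leq : S6 → S6 → Bool
leq F _   = true
leq F₀ F  = false
leq F₀ _  = true
leq n n   = true
leq n T₀  = true
leq n T   = true
leq n _   = false
leq b b   = true
leq b T₀  = true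
leq b T   = true
leq b _   = false
leq T₀ T₀ = true
leq T₀ T  = true
leq T₀ _  = false
leq T T   = true
leq T _   = false

_≤S_ : S6 → S6 → Set
x ≤S y = leq x y ≡ true

-- meet and join (the only incomparable pair is n, b: meet F₀, join T₀)
_⊓_ : S6 → S6 → S6
x ⊓ y = if leq x y then x else (if leq y x then y else F₀)

_⊔_ : S6 → S6 → S6
x ⊔ y = if leq x y then y else (if leq y x then x else T₀)

infix 8 ∼_
∼_ : S6 → S6
∼ T  = F
∼ F  = T
∼ T₀ = F₀
∼ F₀ = T₀
∼ n  = n
∼ b  = b

∇ : S6 → S6
∇ F = F
∇ _ = T

∘S : S6 → S6
∘S x = (∼ ∇ x) ⊔ (∼ ∇ (∼ x))

⟦_⟧ : Formula → (ℕ → S6) → S6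
⟦ var k ⟧ v  = v k
⟦ A ∧′ B ⟧ v = ⟦ A ⟧ v ⊓ ⟦ B ⟧ v
⟦ A ∨′ B ⟧ v = ⟦ A ⟧ v ⊔ ⟦ B ⟧ v
⟦ ¬′ A ⟧ v   = ∼ ⟦ A ⟧ v
⟦ ∘′ A ⟧ v   = ∘S (⟦ A ⟧ v)
⟦ ⊥′ ⟧ v     = F
⟦ ⊤′ ⟧ v     = T

meetVals : Formula → List Formula → (ℕ → S6) → S6
meetVals A₁ []       v = ⟦ A₁ ⟧ v
meetVals A₁ (A ∷ As) v = ⟦ A₁ ⟧ v ⊓ meetVals A As v

infix 3 _⊨≤_
_⊨≤_ : FSet → Formula → Set
Γ ⊨≤ A =
  (∀ (v : ℕ → S6) → ⟦ A ⟧ v ≡ T)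
  ⊎ (Σ Formula λ A₁ → Σ (List Formula) λ As →
       Γ A₁ × All Γ As × (∀ (v : ℕ → S6) → meetVals A₁ As v ≤S ⟦ A ⟧ v))

{-# OPTIONS --safe #-}
-- Soundness: every rule of LET_F^+ is valid in S6 as an inequality between the meet of its
-- premises and its conclusion, and discharged hypotheses are handled by distributivity; so a
-- derivation of A from Γ bounds ⟦A⟧ from below by the meet of finitely many members of Γ.
--
-- Completeness: by simultaneous recursion on A, each of A, ¬A, Aᵀ, Aᶠ and ¬∘A is provably
-- equivalent both to a disjunction of conjunctions and to a conjunction of disjunctions of
-- literals p, ¬p, ∘p, ¬∘p, and by soundness these normal forms agree with A in S6. So if
-- ⟦X⟧ ≤ ⟦Y⟧ it suffices to derive each clause R of Y from each conjunct L of X, knowing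
-- ⋀L ≤ ⋁R in S6. For a variable p the logic can split on ∘p ∧ p | ∘p ∧ ¬p | ¬∘p, mirroring
-- the values T, F and F₀, n, b, T₀. If for some p no value is consistent with L and R, that
-- split derives ⋁R from L; otherwise the consistent values form a valuation which, with ↑n
-- as designated set, makes L true and R false, contradicting ⋀L ≤ ⋁R.
module Submission where

open import Defs
open import Function.Bundles using (_⇔_; mk⇔; Equivalence)
open import Data.Nat using (ℕ)
import Data.Nat as ℕ
open import Data.Bool using (Bool; true; false; _∨_; not)
  renaming (T to True)
open import Data.Bool.Properties using (T-≡)
open import Data.List using (List; []; _∷_; _++_; map; cartesianProductWith)
open import Data.Bool.ListAction using (all)
open import Data.List.Relation.Unary.All as All using (All; []; _∷_)
open import Data.List.Relation.Unary.All.Properties using (all⁺; ++⁺)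
open import Data.List.Relation.Unary.Any using (here; there)
open import Data.List.Membership.Propositional using (_∈_)
open import Data.List.Membership.Propositional.Properties
  using (∈-++⁺ˡ; ∈-++⁺ʳ; ∈-++⁻; ∈-map⁺; ∈-map⁻; ∈-cartesianProductWith⁺; ∈-cartesianProductWith⁻)
open import Data.Product using (Σ; ∃; _×_; _,_; proj₁; proj₂)
open import Data.Product.Properties using (≡-dec)
open import Data.Sum using (_⊎_; inj₁; inj₂)
import Data.Sum as Sum
open import Relation.Nullary using (¬_; yes; no; contradiction)
open import Relation.Nullary.Decidable using (map′)
open import Relation.Unary using (_⊆_)
open import Relation.Binary.Definitions using (DecidableEquality)
open import Relation.Binary.PropositionalEquality using (_≡_; refl; sym; trans; cong; cong₂; subst; subst₂)

private
  variable
    Γ Δ Θ : FSet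
    A B C M X Y Z : Formula
    x y z : S6

-- S6, by exhaustive evaluation

allS6 : List S6
allS6 = F ∷ F₀ ∷ n ∷ b ∷ T₀ ∷ T ∷ []

∈-allS6 : ∀ x → x ∈ allS6
∈-allS6 F  = here refl
∈-allS6 F₀ = there (here refl)
∈-allS6 n  = there (there (here refl))
∈-allS6 b  = there (there (there (here refl)))
∈-allS6 T₀ = there (there (there (there (here refl))))
∈-allS6 T  = there (there (there (there (there (here refl)))))

∀ᵇ : (S6 → Bool) → Bool
∀ᵇ P = all P allS6

exhaust₁ : (P : S6 → Bool) → {True (∀ᵇ P)} → ∀ x → P x ≡ true
exhaust₁ P {h} x = Equivalence.to T-≡ (All.lookup (all⁺ P allS6 h) (∈-allS6 x))

exhaust₂ : (P : S6 → S6 → Bool) → {True (∀ᵇ λ x → ∀ᵇ (P x))} → ∀ x y → P x y ≡ true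
exhaust₂ P {h} x = exhaust₁ (P x) {Equivalence.from T-≡ (exhaust₁ (λ x → ∀ᵇ (P x)) {h} x)}

exhaust₃ : (P : S6 → S6 → S6 → Bool) → {True (∀ᵇ λ x → ∀ᵇ λ y → ∀ᵇ (P x y))} →
           ∀ x y z → P x y z ≡ true
exhaust₃ P {h} x =
  exhaust₂ (P x) {Equivalence.from T-≡ (exhaust₁ (λ x → ∀ᵇ λ y → ∀ᵇ (P x y)) {h} x)}

exhaust₄ : (P : S6 → S6 → S6 → S6 → Bool) →
           {True (∀ᵇ λ x → ∀ᵇ λ y → ∀ᵇ λ z → ∀ᵇ (P x y z))} →
           ∀ x y z w → P x y z w ≡ true
exhaust₄ P {h} x =
  exhaust₃ (P x) {Equivalence.from T-≡ (exhaust₁ (λ x → ∀ᵇ λ y → ∀ᵇ λ z → ∀ᵇ (P x y z)) {h} x)}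

infixr 4 _⇒ᵇ_
_⇒ᵇ_ : Bool → Bool → Bool
p ⇒ᵇ q = not p ∨ q

mp : ∀ {p q} → (p ⇒ᵇ q) ≡ true → p ≡ true → q ≡ true
mp h refl = h

≤-exhaust₁ : (f g : S6 → S6) → {True (∀ᵇ λ x → leq (f x) (g x))} → ∀ x → f x ≤S g x
≤-exhaust₁ f g {h} = exhaust₁ (λ x → leq (f x) (g x)) {h}

≤-exhaust₂ : (f g : S6 → S6 → S6) → {True (∀ᵇ λ x → ∀ᵇ λ y → leq (f x y) (g x y))} →
             ∀ x y → f x y ≤S g x y
≤-exhaust₂ f g {h} = exhaust₂ (λ x y → leq (f x y) (g x y)) {h}

≤-refl : ∀ x → x ≤S x
≤-refl = exhaust₁ (λ x → leq x x)

≤-top : ∀ x → x ≤S T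
≤-top = exhaust₁ (λ x → leq x T)

T-maximum : T ≤S x → x ≡ T
T-maximum {T} _ = refl

≤-trans : x ≤S y → y ≤S z → x ≤S z
≤-trans {x} {y} {z} p q = mp (mp (exhaust₃ (λ x y z → leq x y ⇒ᵇ leq y z ⇒ᵇ leq x z) x y z) p) q

x⊓y≤x : ∀ x y → (x ⊓ y) ≤S x
x⊓y≤x = exhaust₂ (λ x y → leq (x ⊓ y) x)

x⊓y≤y : ∀ x y → (x ⊓ y) ≤S y
x⊓y≤y = exhaust₂ (λ x y → leq (x ⊓ y) y)

⊓-glb : ∀ {h} → h ≤S x → h ≤S y → h ≤S (x ⊓ y)
⊓-glb {x} {y} {h} p q = mp (mp (exhaust₃ (λ h x y → leq h x ⇒ᵇ leq h y ⇒ᵇ leq h (x ⊓ y)) h x y) p) q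

⊓-monoˡ : ∀ z → x ≤S y → (x ⊓ z) ≤S (y ⊓ z)
⊓-monoˡ {x} {y} z = mp (exhaust₃ (λ x y z → leq x y ⇒ᵇ leq (x ⊓ z) (y ⊓ z)) x y z)

⊓-monoʳ : ∀ z → x ≤S y → (z ⊓ x) ≤S (z ⊓ y)
⊓-monoʳ {x} {y} z = mp (exhaust₃ (λ x y z → leq x y ⇒ᵇ leq (z ⊓ x) (z ⊓ y)) x y z)

⊔-elim : ∀ {h c} → h ≤S (x ⊔ y) → (h ⊓ x) ≤S c → (h ⊓ y) ≤S c → h ≤S c
⊔-elim {x} {y} {h} {c} p q r =
  mp (mp (mp (exhaust₄ (λ h x y c → leq h (x ⊔ y) ⇒ᵇ leq (h ⊓ x) c ⇒ᵇ leq (h ⊓ y) c ⇒ᵇ leq h c)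
                       h x y c) p) q) r

-- The prime filter generated by n. Which of p, ¬p, ∘p, ¬∘p it contains determines the value
-- of p, so it serves as the designated set of every countermodel below.
↑n : S6 → Bool
↑n n  = true
↑n T₀ = true
↑n T  = true
↑n _  = false

↑n-mono : x ≤S y → ↑n x ≡ true → ↑n y ≡ true
↑n-mono {x} {y} p = mp (mp (exhaust₂ (λ x y → leq x y ⇒ᵇ ↑n x ⇒ᵇ ↑n y) x y) p)

↑n-⊓ : ↑n x ≡ true → ↑n y ≡ true → ↑n (x ⊓ y) ≡ true
↑n-⊓ {x} {y} p = mp (mp (exhaust₂ (λ x y → ↑n x ⇒ᵇ ↑n y ⇒ᵇ ↑n (x ⊓ y)) x y) p)

↑n-⊔ : ↑n (x ⊔ y) ≡ true → ↑n x ≡ true ⊎ ↑n y ≡ true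
↑n-⊔ {x} {y} p = split (mp (exhaust₂ (λ x y → ↑n (x ⊔ y) ⇒ᵇ ↑n x ∨ ↑n y) x y) p)
  where
  split : ∀ {p q} → p ∨ q ≡ true → p ≡ true ⊎ q ≡ true
  split {true}  _ = inj₁ refl
  split {false} h = inj₂ h

-- Soundness

meet : List Formula → (ℕ → S6) → S6
meet []       v = T
meet (H ∷ Hs) v = ⟦ H ⟧ v ⊓ meet Hs v

infix 3 _⊨⋀_
record _⊨⋀_ (Γ : FSet) (A : Formula) : Set where
  constructor entails
  field
    premises   : List Formula
    premises∈Γ : All Γ premises
    bound      : ∀ v → meet premises v ≤S ⟦ A ⟧ v

meet-++ˡ : ∀ Hs Ks v → meet (Hs ++ Ks) v ≤S meet Hs v
meet-++ˡ []       Ks v = ≤-top _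
meet-++ˡ (H ∷ Hs) Ks v = ⊓-monoʳ (⟦ H ⟧ v) (meet-++ˡ Hs Ks v)

meet-++ʳ : ∀ Hs Ks v → meet (Hs ++ Ks) v ≤S meet Ks v
meet-++ʳ []       Ks v = ≤-refl _
meet-++ʳ (H ∷ Hs) Ks v = ≤-trans (x⊓y≤y (⟦ H ⟧ v) _) (meet-++ʳ Hs Ks v)

⊨⋀-hyp : Γ A → Γ ⊨⋀ A
⊨⋀-hyp {A = A} A∈Γ = entails (A ∷ []) (A∈Γ ∷ []) λ v → x⊓y≤x (⟦ A ⟧ v) T

⊨⋀-top : (∀ v → T ≤S ⟦ A ⟧ v) → Γ ⊨⋀ A
⊨⋀-top = entails [] []

⊨⋀-map : Γ ⊨⋀ A → (∀ v → ⟦ A ⟧ v ≤S ⟦ B ⟧ v) → Γ ⊨⋀ B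
⊨⋀-map (entails Hs Hs∈ p) A≤B = entails Hs Hs∈ λ v → ≤-trans (p v) (A≤B v)

⊨⋀-∧ : Γ ⊨⋀ A → Γ ⊨⋀ B → Γ ⊨⋀ A ∧′ B
⊨⋀-∧ (entails Hs Hs∈ p) (entails Ks Ks∈ q) = entails (Hs ++ Ks) (++⁺ Hs∈ Ks∈) λ v →
  ⊓-glb (≤-trans (meet-++ˡ Hs Ks v) (p v)) (≤-trans (meet-++ʳ Hs Ks v) (q v))

discharge : ∀ {Hs} → All (Γ ,, A) Hs →
            Σ (List Formula) λ Ks → All Γ Ks × ∀ v → (meet Ks v ⊓ ⟦ A ⟧ v) ≤S meet Hs v
discharge [] = [] , [] , λ v → ≤-top _
discharge {A = A} {H ∷ _} (inj₁ H∈Γ ∷ H∈s) with discharge H∈s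
... | Ks , Ks∈ , p = H ∷ Ks , H∈Γ ∷ Ks∈ , λ v →
  ⊓-glb (≤-trans (x⊓y≤x _ (⟦ A ⟧ v)) (x⊓y≤x (⟦ H ⟧ v) _))
        (≤-trans (⊓-monoˡ (⟦ A ⟧ v) (x⊓y≤y (⟦ H ⟧ v) _)) (p v))
discharge {A = A} (inj₂ refl ∷ H∈s) with discharge H∈s
... | Ks , Ks∈ , p = Ks , Ks∈ , λ v → ⊓-glb (x⊓y≤y (meet Ks v) (⟦ A ⟧ v)) (p v)

⊨⋀-cases : Γ ⊨⋀ M → (∀ v → ⟦ M ⟧ v ≤S (⟦ A ⟧ v ⊔ ⟦ B ⟧ v)) →
           (Γ ,, A) ⊨⋀ C → (Γ ,, B) ⊨⋀ C → Γ ⊨⋀ C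
⊨⋀-cases {A = A} {B = B} (entails H₀ H₀∈ p) M≤A⊔B (entails H₁ H₁∈ q) (entails H₂ H₂∈ r)
  with discharge H₁∈ | discharge H₂∈
... | K₁ , K₁∈ , s | K₂ , K₂∈ , t =
  entails (H₀ ++ K₁ ++ K₂) (++⁺ H₀∈ (++⁺ K₁∈ K₂∈)) λ v →
    ⊔-elim (≤-trans (meet-++ˡ H₀ _ v) (≤-trans (p v) (M≤A⊔B v)))
      (≤-trans (⊓-monoˡ (⟦ A ⟧ v) (≤-trans (meet-++ʳ H₀ _ v) (meet-++ˡ K₁ K₂ v)))
               (≤-trans (s v) (q v)))
      (≤-trans (⊓-monoˡ (⟦ B ⟧ v) (≤-trans (meet-++ʳ H₀ _ v) (meet-++ʳ K₁ K₂ v)))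
               (≤-trans (t v) (r v)))

soundness : Γ ⊢ A → Γ ⊨⋀ A
soundness (hyp A∈Γ) = ⊨⋀-hyp A∈Γ
soundness (∧I d e) = ⊨⋀-∧ (soundness d) (soundness e)
soundness (∧E₁ {A = A} {B} d) = ⊨⋀-map (soundness d) λ v → x⊓y≤x (⟦ A ⟧ v) (⟦ B ⟧ v)
soundness (∧E₂ {A = A} {B} d) = ⊨⋀-map (soundness d) λ v → x⊓y≤y (⟦ A ⟧ v) (⟦ B ⟧ v)
soundness (∨I₁ {A = A} {B} d) = ⊨⋀-map (soundness d) λ v →
  ≤-exhaust₂ (λ a b → a) (λ a b → a ⊔ b) (⟦ A ⟧ v) (⟦ B ⟧ v)
soundness (∨I₂ {A = A} {B} d) = ⊨⋀-map (soundness d) λ v →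
  ≤-exhaust₂ (λ a b → b) (λ a b → a ⊔ b) (⟦ A ⟧ v) (⟦ B ⟧ v)
soundness (∨E d e f) = ⊨⋀-cases (soundness d) (λ v → ≤-refl _) (soundness e) (soundness f)
soundness (¬∧I₁ {A = A} {B} d) = ⊨⋀-map (soundness d) λ v →
  ≤-exhaust₂ (λ a b → ∼ a) (λ a b → ∼ (a ⊓ b)) (⟦ A ⟧ v) (⟦ B ⟧ v)
soundness (¬∧I₂ {A = A} {B} d) = ⊨⋀-map (soundness d) λ v →
  ≤-exhaust₂ (λ a b → ∼ b) (λ a b → ∼ (a ⊓ b)) (⟦ A ⟧ v) (⟦ B ⟧ v)
soundness (¬∧E {A = A} {B} d e f) = ⊨⋀-cases (soundness d)
  (λ v → ≤-exhaust₂ (λ a b → ∼ (a ⊓ b)) (λ a b → (∼ a) ⊔ (∼ b)) (⟦ A ⟧ v) (⟦ B ⟧ v))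
  (soundness e) (soundness f)
soundness (¬∨I {A = A} {B} d e) = ⊨⋀-map (⊨⋀-∧ (soundness d) (soundness e)) λ v →
  ≤-exhaust₂ (λ a b → (∼ a) ⊓ (∼ b)) (λ a b → ∼ (a ⊔ b)) (⟦ A ⟧ v) (⟦ B ⟧ v)
soundness (¬∨E₁ {A = A} {B} d) = ⊨⋀-map (soundness d) λ v →
  ≤-exhaust₂ (λ a b → ∼ (a ⊔ b)) (λ a b → ∼ a) (⟦ A ⟧ v) (⟦ B ⟧ v)
soundness (¬∨E₂ {A = A} {B} d) = ⊨⋀-map (soundness d) λ v →
  ≤-exhaust₂ (λ a b → ∼ (a ⊔ b)) (λ a b → ∼ b) (⟦ A ⟧ v) (⟦ B ⟧ v)
soundness (DNI {A = A} d) = ⊨⋀-map (soundness d) λ v → ≤-exhaust₁ (λ a → a) (λ a → ∼ ∼ a) (⟦ A ⟧ v)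
soundness (DNE {A = A} d) = ⊨⋀-map (soundness d) λ v → ≤-exhaust₁ (λ a → ∼ ∼ a) (λ a → a) (⟦ A ⟧ v)
soundness (EXP∘ {A = A} {B} c d e) =
  ⊨⋀-map (⊨⋀-∧ (⊨⋀-∧ (soundness c) (soundness d)) (soundness e)) λ v →
  ≤-exhaust₂ (λ a b → (∘S a ⊓ a) ⊓ (∼ a)) (λ a b → b) (⟦ A ⟧ v) (⟦ B ⟧ v)
soundness (PEM∘ {A = A} d) = ⊨⋀-map (soundness d) λ v → ≤-exhaust₁ (λ a → ∘S a) (λ a → a ⊔ (∼ a)) (⟦ A ⟧ v)
soundness (I∘ {A = A}) = ⊨⋀-top λ v → ≤-exhaust₁ (λ a → T) (λ a → ∘S (∘S a)) (⟦ A ⟧ v)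
soundness (I¬∘ {A = A} d) = ⊨⋀-map (soundness d) λ v → ≤-exhaust₁ (λ a → ∘S a) (λ a → ∘S (∼ a)) (⟦ A ⟧ v)
soundness (E¬∘ {A = A} d) = ⊨⋀-map (soundness d) λ v → ≤-exhaust₁ (λ a → ∘S (∼ a)) (λ a → ∘S a) (⟦ A ⟧ v)
soundness (I∧T {A = A} {B} d e) = ⊨⋀-map (⊨⋀-∧ (soundness d) (soundness e)) λ v →
  ≤-exhaust₂ (λ a b → (∘S a ⊓ a) ⊓ (∘S b ⊓ b)) (λ a b → ∘S (a ⊓ b) ⊓ (a ⊓ b)) (⟦ A ⟧ v) (⟦ B ⟧ v)
soundness (I∧F₁ {A = A} {B} d) = ⊨⋀-map (soundness d) λ v →
  ≤-exhaust₂ (λ a b → ∘S a ⊓ (∼ a)) (λ a b → ∘S (a ⊓ b) ⊓ (∼ (a ⊓ b))) (⟦ A ⟧ v) (⟦ B ⟧ v)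
soundness (I∧F₂ {A = A} {B} d) = ⊨⋀-map (soundness d) λ v →
  ≤-exhaust₂ (λ a b → ∘S b ⊓ (∼ b)) (λ a b → ∘S (a ⊓ b) ⊓ (∼ (a ⊓ b))) (⟦ A ⟧ v) (⟦ B ⟧ v)
soundness (I∨T₁ {A = A} {B} d) = ⊨⋀-map (soundness d) λ v →
  ≤-exhaust₂ (λ a b → ∘S a ⊓ a) (λ a b → ∘S (a ⊔ b) ⊓ (a ⊔ b)) (⟦ A ⟧ v) (⟦ B ⟧ v)
soundness (I∨T₂ {A = A} {B} d) = ⊨⋀-map (soundness d) λ v →
  ≤-exhaust₂ (λ a b → ∘S b ⊓ b) (λ a b → ∘S (a ⊔ b) ⊓ (a ⊔ b)) (⟦ A ⟧ v) (⟦ B ⟧ v)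
soundness (I∨F {A = A} {B} d e) = ⊨⋀-map (⊨⋀-∧ (soundness d) (soundness e)) λ v →
  ≤-exhaust₂ (λ a b → (∘S a ⊓ (∼ a)) ⊓ (∘S b ⊓ (∼ b))) (λ a b → ∘S (a ⊔ b) ⊓ (∼ (a ⊔ b)))
             (⟦ A ⟧ v) (⟦ B ⟧ v)
soundness (E∧T₁ {A = A} {B} d) = ⊨⋀-map (soundness d) λ v →
  ≤-exhaust₂ (λ a b → ∘S (a ⊓ b) ⊓ (a ⊓ b)) (λ a b → ∘S a ⊓ a) (⟦ A ⟧ v) (⟦ B ⟧ v)
soundness (E∧T₂ {A = A} {B} d) = ⊨⋀-map (soundness d) λ v →
  ≤-exhaust₂ (λ a b → ∘S (a ⊓ b) ⊓ (a ⊓ b)) (λ a b → ∘S b ⊓ b) (⟦ A ⟧ v) (⟦ B ⟧ v)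
soundness (E∧F {A = A} {B} d e f) = ⊨⋀-cases (soundness d)
  (λ v → ≤-exhaust₂ (λ a b → ∘S (a ⊓ b) ⊓ (∼ (a ⊓ b))) (λ a b → (∘S a ⊓ (∼ a)) ⊔ (∘S b ⊓ (∼ b)))
                    (⟦ A ⟧ v) (⟦ B ⟧ v))
  (soundness e) (soundness f)
soundness (E∨T {A = A} {B} d e f) = ⊨⋀-cases (soundness d)
  (λ v → ≤-exhaust₂ (λ a b → ∘S (a ⊔ b) ⊓ (a ⊔ b)) (λ a b → (∘S a ⊓ a) ⊔ (∘S b ⊓ b))
                    (⟦ A ⟧ v) (⟦ B ⟧ v))
  (soundness e) (soundness f)
soundness (E∨F₁ {A = A} {B} d) = ⊨⋀-map (soundness d) λ v →
  ≤-exhaust₂ (λ a b → ∘S (a ⊔ b) ⊓ (∼ (a ⊔ b))) (λ a b → ∘S a ⊓ (∼ a)) (⟦ A ⟧ v) (⟦ B ⟧ v)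
soundness (E∨F₂ {A = A} {B} d) = ⊨⋀-map (soundness d) λ v →
  ≤-exhaust₂ (λ a b → ∘S (a ⊔ b) ⊓ (∼ (a ⊔ b))) (λ a b → ∘S b ⊓ (∼ b)) (⟦ A ⟧ v) (⟦ B ⟧ v)

infix 4 _⊨_
_⊨_ : (ℕ → S6) → Formula → Set
v ⊨ A = ↑n (⟦ A ⟧ v) ≡ true

⊢-preserves-⊨ : ∀ {v} → Γ ⊢ A → (∀ {B} → Γ B → v ⊨ B) → v ⊨ A
⊢-preserves-⊨ {v = v} d v⊨Γ with soundness d
... | entails Hs Hs∈ p = ↑n-mono (p v) (meet-↑n (All.map v⊨Γ Hs∈))
  where
  meet-↑n : ∀ {Hs} → All (v ⊨_) Hs → ↑n (meet Hs v) ≡ true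
  meet-↑n []       = refl
  meet-↑n (h ∷ hs) = ↑n-⊓ h (meet-↑n hs)

-- Derived rules

wk : Γ ⊆ Δ → Γ ⊢ A → Δ ⊢ A
wk s (hyp A∈Γ) = hyp (s A∈Γ)
wk s (∧I d e) = ∧I (wk s d) (wk s e)
wk s (∧E₁ d) = ∧E₁ (wk s d)
wk s (∧E₂ d) = ∧E₂ (wk s d)
wk s (∨I₁ d) = ∨I₁ (wk s d)
wk s (∨I₂ d) = ∨I₂ (wk s d)
wk s (∨E d e f) = ∨E (wk s d) (wk (Sum.map₁ s) e) (wk (Sum.map₁ s) f)
wk s (¬∧I₁ d) = ¬∧I₁ (wk s d)
wk s (¬∧I₂ d) = ¬∧I₂ (wk s d)
wk s (¬∧E d e f) = ¬∧E (wk s d) (wk (Sum.map₁ s) e) (wk (Sum.map₁ s) f)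
wk s (¬∨I d e) = ¬∨I (wk s d) (wk s e)
wk s (¬∨E₁ d) = ¬∨E₁ (wk s d)
wk s (¬∨E₂ d) = ¬∨E₂ (wk s d)
wk s (DNI d) = DNI (wk s d)
wk s (DNE d) = DNE (wk s d)
wk s (EXP∘ c d e) = EXP∘ (wk s c) (wk s d) (wk s e)
wk s (PEM∘ d) = PEM∘ (wk s d)
wk s I∘ = I∘
wk s (I¬∘ d) = I¬∘ (wk s d)
wk s (E¬∘ d) = E¬∘ (wk s d)
wk s (I∧T d e) = I∧T (wk s d) (wk s e)
wk s (I∧F₁ d) = I∧F₁ (wk s d)
wk s (I∧F₂ d) = I∧F₂ (wk s d)
wk s (I∨T₁ d) = I∨T₁ (wk s d)
wk s (I∨T₂ d) = I∨T₂ (wk s d)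
wk s (I∨F d e) = I∨F (wk s d) (wk s e)
wk s (E∧T₁ d) = E∧T₁ (wk s d)
wk s (E∧T₂ d) = E∧T₂ (wk s d)
wk s (E∧F d e f) = E∧F (wk s d) (wk (Sum.map₁ s) e) (wk (Sum.map₁ s) f)
wk s (E∨T d e f) = E∨T (wk s d) (wk (Sum.map₁ s) e) (wk (Sum.map₁ s) f)
wk s (E∨F₁ d) = E∨F₁ (wk s d)
wk s (E∨F₂ d) = E∨F₂ (wk s d)

infix 4 _⇛_
_⇛_ : FSet → FSet → Set₁
Γ ⇛ Δ = ∀ {X} → Γ ⊢ X → Δ ⊢ X

⇛-trans : Γ ⇛ Δ → Δ ⇛ Θ → Γ ⇛ Θ
⇛-trans w w′ d = w′ (w d)

-- A branch of a case split works in every context Δ into which Γ's consequences transfer,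
-- so nested case splits never weaken explicitly.
Branch : FSet → Formula → Formula → Set₁
Branch Γ A C = ∀ {Δ} → Γ ⇛ Δ → Δ ⊢ A → Δ ⊢ C

cases : Γ ⊢ A ∨′ B → Branch Γ A C → Branch Γ B C → Γ ⊢ C
cases d f g = ∨E d (f (wk inj₁) (hyp (inj₂ refl))) (g (wk inj₁) (hyp (inj₂ refl)))

cases₃ : Γ ⊢ A ∨′ (B ∨′ C) → Branch Γ A Z → Branch Γ B Z → Branch Γ C Z → Γ ⊢ Z
cases₃ d f g h = cases d f λ w e → cases e (λ w′ → g (⇛-trans w w′)) (λ w′ → h (⇛-trans w w′))

contra : Γ ⊢ ∘′ A → Γ ⊢ ¬′ ∘′ A → Γ ⊢ C
contra = EXP∘ I∘

ᵀ-ᶠ-conflict : Γ ⊢ A ᵀ → Γ ⊢ A ᶠ → Γ ⊢ C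
ᵀ-ᶠ-conflict t f = EXP∘ (∧E₁ t) (∧E₂ t) (∧E₂ f)

ᵀ-¬∘-conflict : Γ ⊢ A ᵀ → Γ ⊢ ¬′ ∘′ A → Γ ⊢ C
ᵀ-¬∘-conflict t = contra (∧E₁ t)

ᶠ-¬∘-conflict : Γ ⊢ A ᶠ → Γ ⊢ ¬′ ∘′ A → Γ ⊢ C
ᶠ-¬∘-conflict f = contra (∧E₁ f)

trichotomy : ∀ A → Branch Γ (A ᵀ) C → Branch Γ (A ᶠ) C → Branch Γ (¬′ ∘′ A) C → Γ ⊢ C
trichotomy A t f u = cases (PEM∘ (I∘ {A = A}))
  (λ w c → cases (PEM∘ c) (λ w′ a → t (⇛-trans w w′) (∧I (w′ c) a))
                          (λ w′ a → f (⇛-trans w w′) (∧I (w′ c) a)))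
  u

¬∘-intro : Branch Γ (A ᵀ) (¬′ ∘′ A) → Branch Γ (A ᶠ) (¬′ ∘′ A) → Γ ⊢ ¬′ ∘′ A
¬∘-intro {A = A} t f = trichotomy A t f (λ _ u → u)

∨-mapˡ : (∀ {Δ} → Δ ⊢ A → Δ ⊢ B) → Γ ⊢ A ∨′ C → Γ ⊢ B ∨′ C
∨-mapˡ f d = cases d (λ _ a → ∨I₁ (f a)) (λ _ c → ∨I₂ c)

∨-assocˡ : Γ ⊢ A ∨′ (B ∨′ C) → Γ ⊢ (A ∨′ B) ∨′ C
∨-assocˡ d = cases₃ d (λ _ a → ∨I₁ (∨I₁ a)) (λ _ b → ∨I₁ (∨I₂ b)) (λ _ c → ∨I₂ c)

∨-assocʳ : Γ ⊢ (A ∨′ B) ∨′ C → Γ ⊢ A ∨′ (B ∨′ C)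
∨-assocʳ d = cases d (λ _ e → cases e (λ _ a → ∨I₁ a) (λ _ b → ∨I₂ (∨I₁ b))) (λ _ c → ∨I₂ (∨I₂ c))

∨-exchange : Γ ⊢ A ∨′ (B ∨′ C) → Γ ⊢ B ∨′ (A ∨′ C)
∨-exchange d = cases₃ d (λ _ a → ∨I₂ (∨I₁ a)) (λ _ b → ∨I₁ b) (λ _ c → ∨I₂ (∨I₂ c))

∧-∨-distrib : Γ ⊢ A ∨′ C → Γ ⊢ B ∨′ C → Γ ⊢ (A ∧′ B) ∨′ C
∧-∨-distrib d e = cases d (λ w a → cases (w e) (λ w′ b → ∨I₁ (∧I (w′ a) b)) (λ _ c → ∨I₂ c))
                          (λ _ c → ∨I₂ c)

⊢⊤ : Γ ⊢ ⊤def
⊢⊤ = PEM∘ I∘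

⊢⊤ᵀ : Γ ⊢ ⊤def ᵀ
⊢⊤ᵀ = cases ⊢⊤ (λ _ c → I∨T₁ (∧I I∘ c)) (λ _ u → I∨T₂ (∧I (I¬∘ I∘) u))

⊥def-elim : Γ ⊢ ⊥def → Γ ⊢ C
⊥def-elim d = contra (DNE (¬∨E₂ d)) (¬∨E₁ d)

∨⊥-elim : Γ ⊢ A ∨′ ⊥def → Γ ⊢ A
∨⊥-elim d = cases d (λ _ a → a) (λ _ e → ⊥def-elim e)

data Kind : Set where
  pos neg circ ncirc : Kind

kindCode : Kind → ℕ
kindCode pos   = 0
kindCode neg   = 1
kindCode circ  = 2
kindCode ncirc = 3

kindCode-injective : ∀ {K K′} → kindCode K ≡ kindCode K′ → K ≡ K′
kindCode-injective {pos}   {pos}   _ = refl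
kindCode-injective {neg}   {neg}   _ = refl
kindCode-injective {circ}  {circ}  _ = refl
kindCode-injective {ncirc} {ncirc} _ = refl

_≟ᴷ_ : DecidableEquality Kind
K ≟ᴷ K′ = map′ kindCode-injective (cong kindCode) (kindCode K ℕ.≟ kindCode K′)

byKind : (P : Kind → Set) → P pos → P neg → P circ → P ncirc → ∀ K → P K
byKind P p _ _ _ pos   = p
byKind P _ q _ _ neg   = q
byKind P _ _ r _ circ  = r
byKind P _ _ _ s ncirc = s

∀-Kind? : {P Q : Kind → Set} → (∀ K → P K ⊎ Q K) → (∀ K → P K) ⊎ ∃ Q
∀-Kind? d with d pos | d neg | d circ | d ncirc
... | inj₁ p | inj₁ q | inj₁ r | inj₁ s = inj₁ (byKind _ p q r s)
... | inj₂ e | _      | _      | _      = inj₂ (pos , e)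
... | _      | inj₂ e | _      | _      = inj₂ (neg , e)
... | _      | _      | inj₂ e | _      = inj₂ (circ , e)
... | _      | _      | _      | inj₂ e = inj₂ (ncirc , e)

kindF : Kind → Formula → Formula
kindF pos   A = A
kindF neg   A = ¬′ A
kindF circ  A = ∘′ A
kindF ncirc A = ¬′ ∘′ A

Lit : Set
Lit = Kind × ℕ

_≟ˡ_ : DecidableEquality Lit
_≟ˡ_ = ≡-dec _≟ᴷ_ ℕ._≟_

open import Data.List.Membership.DecPropositional _≟ˡ_ using (_∈?_)

litF : Lit → Formula
litF (K , k) = kindF K (var k)

⋁′ : List Lit → Formula
⋁′ []      = ⊥def
⋁′ (l ∷ R) = litF l ∨′ ⋁′ R

infix 3 _⊢*_
_⊢*_ : FSet → List Lit → Set₁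
Γ ⊢* L = ∀ {l} → l ∈ L → Γ ⊢ litF l

⊢*-lift : Γ ⇛ Δ → ∀ {L} → Γ ⊢* L → Δ ⊢* L
⊢*-lift w ⊢L l∈ = w (⊢L l∈)

⊢*-++ : ∀ {L M} → Γ ⊢* L → Γ ⊢* M → Γ ⊢* L ++ M
⊢*-++ {L = L} ⊢L ⊢M l∈ with ∈-++⁻ L l∈
... | inj₁ l∈L = ⊢L l∈L
... | inj₂ l∈M = ⊢M l∈M

⋁′-intro : ∀ {l R} → l ∈ R → Γ ⊢ litF l → Γ ⊢ ⋁′ R
⋁′-intro (here refl) d = ∨I₁ d
⋁′-intro (there l∈)  d = ∨I₂ (⋁′-intro l∈ d)

⋁′-elim : ∀ {R} → Γ ⊢ ⋁′ R → (∀ {l} → l ∈ R → Branch Γ (litF l) C) → Γ ⊢ C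
⋁′-elim {R = []}    d _ = ⊥def-elim d
⋁′-elim {R = _ ∷ _} d k = cases d (k (here refl)) λ w e →
  ⋁′-elim e λ l∈ w′ → k (there l∈) (⇛-trans w w′)

⋁′-++⁺ˡ : ∀ {R S} → Γ ⊢ ⋁′ R → Γ ⊢ ⋁′ (R ++ S)
⋁′-++⁺ˡ d = ⋁′-elim d λ l∈ _ → ⋁′-intro (∈-++⁺ˡ l∈)

⋁′-++⁺ʳ : ∀ R {S} → Γ ⊢ ⋁′ S → Γ ⊢ ⋁′ (R ++ S)
⋁′-++⁺ʳ R d = ⋁′-elim d λ l∈ _ → ⋁′-intro (∈-++⁺ʳ R l∈)

⋁′-++⁻ : ∀ R {S} → Γ ⊢ ⋁′ (R ++ S) → Γ ⊢ ⋁′ R ∨′ ⋁′ S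
⋁′-++⁻ R d = ⋁′-elim d λ l∈ _ → inject (∈-++⁻ R l∈)
  where
  inject : ∀ {l S} → l ∈ R ⊎ l ∈ S → Δ ⊢ litF l → Δ ⊢ ⋁′ R ∨′ ⋁′ S
  inject (inj₁ l∈R) e = ∨I₁ (⋁′-intro l∈R e)
  inject (inj₂ l∈S) e = ∨I₂ (⋁′-intro l∈S e)

kindVal : Kind → S6 → S6
kindVal pos   x = x
kindVal neg   x = ∼ x
kindVal circ  x = ∘S x
kindVal ncirc x = ∼ ∘S x

profile : S6 → Kind → Bool
profile x K = ↑n (kindVal K x)

⊨-lit : ∀ K k v → ↑n (⟦ litF (K , k) ⟧ v) ≡ profile (v k) K
⊨-lit pos   k v = refl
⊨-lit neg   k v = refl
⊨-lit circ  k v = refl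
⊨-lit ncirc k v = refl

infix 3 _⊨*_
_⊨*_ : (ℕ → S6) → List Lit → Set
v ⊨* L = ∀ {l} → l ∈ L → v ⊨ litF l

∘x⊔¬∘x≡T : ∀ x → (∘S x ⊔ (∼ ∘S x)) ≡ T
∘x⊔¬∘x≡T = λ { F → refl ; F₀ → refl ; n → refl ; b → refl ; T₀ → refl ; T → refl }

⊤def-true : ∀ v → ⟦ ⊤def ⟧ v ≡ T
⊤def-true v = ∘x⊔¬∘x≡T (v 0)

⊥def-false : ∀ v → ⟦ ⊥def ⟧ v ≡ F
⊥def-false v = cong ∼_ (⊤def-true v)

⊨⋁′ : ∀ {v} R → v ⊨ ⋁′ R → ∃ λ l → l ∈ R × v ⊨ litF l
⊨⋁′ {v} [] h with subst (λ x → ↑n x ≡ true) (⊥def-false v) h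
... | ()
⊨⋁′ (l ∷ R) h with ↑n-⊔ h
... | inj₁ hl = l , here refl , hl
... | inj₂ hR with ⊨⋁′ R hR
...   | l′ , l′∈ , hl′ = l′ , there l′∈ , hl′

-- Sequents of literals

Settles : FSet → Formula → Bool → Set₁
Settles Γ X true  = Γ ⊢ X
Settles Γ X false = ∀ {C} → Γ ⊢ X → Γ ⊢ C

settledᵀ : Γ ⊢ ∘′ A → Γ ⊢ A → ∀ K → Settles Γ (kindF K A) (profile T K)
settledᵀ c a pos   = a
settledᵀ c a neg   = EXP∘ c a
settledᵀ c a circ  = c
settledᵀ c a ncirc = contra c

settledᶠ : Γ ⊢ ∘′ A → Γ ⊢ ¬′ A → ∀ K → Settles Γ (kindF K A) (profile F K)
settledᶠ c na pos   = λ a → EXP∘ c a na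
settledᶠ c na neg   = na
settledᶠ c na circ  = c
settledᶠ c na ncirc = contra c

mid : Bool → Bool → S6
mid true  true  = n
mid true  false = T₀
mid false true  = F₀
mid false false = b

module Atomic (L R : List Lit) where

  Fits : Lit → Bool → Set
  Fits l h = (l ∈ L → h ≡ true) × (l ∈ R → h ≡ false)

  Fails : Lit → Bool → Set
  Fails l h = (l ∈ L × h ≡ false) ⊎ (l ∈ R × h ≡ true)

  Clash : Lit → Set
  Clash l = l ∈ L × l ∈ R

  fits? : ∀ l h → Fits l h ⊎ Fails l h
  fits? l true with l ∈? R
  ... | yes l∈R = inj₂ (inj₂ (l∈R , refl))
  ... | no  l∉R = inj₁ ((λ _ → refl) , λ l∈R → contradiction l∈R l∉R)
  fits? l false with l ∈? L
  ... | yes l∈L = inj₂ (inj₁ (l∈L , refl))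
  ... | no  l∉L = inj₁ ((λ l∈L → contradiction l∈L l∉L) , λ _ → refl)

  clash? : ∀ l → Clash l ⊎ ∃ (Fits l)
  clash? l with l ∈? L | l ∈? R
  ... | yes l∈L | yes l∈R = inj₁ (l∈L , l∈R)
  ... | yes _   | no  l∉R = inj₂ (true , (λ _ → refl) , λ l∈R → contradiction l∈R l∉R)
  ... | no  l∉L | _       = inj₂ (false , (λ l∈L → contradiction l∈L l∉L) , λ _ → refl)

  FitsAt : ℕ → S6 → Set
  FitsAt k x = ∀ K → Fits (K , k) (profile x K)

  FailsAt : ℕ → S6 → Set
  FailsAt k x = ∃ λ K → Fails (K , k) (profile x K)

  fitsAt? : ∀ k x → FitsAt k x ⊎ FailsAt k x
  fitsAt? k x = ∀-Kind? λ K → fits? (K , k) (profile x K)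

  -- Under ¬∘p the value of p is one of F₀, n, b, T₀: there ∘p is false, ¬∘p true, and the
  -- truths of p and ¬p are independent. So none of them fits exactly in these cases.
  MiddleFails : ℕ → Set
  MiddleFails k = Fails (circ , k) false ⊎ Fails (ncirc , k) true ⊎ ∃ λ K → Clash (K , k)

  fitsAt-mid : ∀ {k} s t → Fits (pos , k) s → Fits (neg , k) t →
               Fits (circ , k) false → Fits (ncirc , k) true → FitsAt k (mid s t)
  fitsAt-mid {k} true  true  = byKind (λ K → Fits (K , k) (profile n K))
  fitsAt-mid {k} true  false = byKind (λ K → Fits (K , k) (profile T₀ K))
  fitsAt-mid {k} false true  = byKind (λ K → Fits (K , k) (profile F₀ K))
  fitsAt-mid {k} false false = byKind (λ K → Fits (K , k) (profile b K))

  middle? : ∀ k → ∃ (FitsAt k) ⊎ MiddleFails k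
  middle? k with fits? (circ , k) false | fits? (ncirc , k) true | clash? (pos , k) | clash? (neg , k)
  ... | inj₁ fc | inj₁ fnc | inj₂ (s , fp) | inj₂ (t , fn) = inj₁ (mid s t , fitsAt-mid s t fp fn fc fnc)
  ... | inj₂ e | _      | _      | _      = inj₂ (inj₁ e)
  ... | _      | inj₂ e | _      | _      = inj₂ (inj₂ (inj₁ e))
  ... | _      | _      | inj₁ c | _      = inj₂ (inj₂ (inj₂ (pos , c)))
  ... | _      | _      | _      | inj₁ c = inj₂ (inj₂ (inj₂ (neg , c)))

  record Refuted (k : ℕ) : Set where
    constructor refuted
    field
      atT      : FailsAt k T
      atF      : FailsAt k F
      atMiddle : MiddleFails k

  -- The value b of a refuted variable is arbitrary: counter is used only when there is none.
  choose : ∀ k → Σ S6 λ x → FitsAt k x ⊎ Refuted k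
  choose k with fitsAt? k T | fitsAt? k F | middle? k
  ... | inj₁ fit | _        | _              = T , inj₁ fit
  ... | inj₂ _   | inj₁ fit | _              = F , inj₁ fit
  ... | inj₂ _   | inj₂ _   | inj₁ (x , fit) = x , inj₁ fit
  ... | inj₂ fT  | inj₂ fF  | inj₂ fM        = b , inj₂ (refuted fT fF fM)

  counter : ℕ → S6
  counter k = proj₁ (choose k)

  CounterFits : List Lit → Set
  CounterFits Ms = ∀ {l} → l ∈ Ms → Fits l (profile (counter (proj₂ l)) (proj₁ l))

  search : ∀ Ms → Σ ℕ Refuted ⊎ CounterFits Ms
  search [] = inj₂ λ ()
  search ((K , k) ∷ Ms) with proj₂ (choose k) | search Ms
  ... | inj₂ r   | _         = inj₁ (k , r)
  ... | inj₁ _   | inj₁ r    = inj₁ r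
  ... | inj₁ fit | inj₂ fits = inj₂ λ { (here refl) → fit K ; (there l∈) → fits l∈ }

  counter⊨L : CounterFits (L ++ R) → counter ⊨* L
  counter⊨L fits {K , k} l∈L = trans (⊨-lit K k counter) (proj₁ (fits (∈-++⁺ˡ l∈L)) l∈L)

  counter⊭R : CounterFits (L ++ R) → ∀ {l} → l ∈ R → ¬ counter ⊨ litF l
  counter⊭R fits {K , k} l∈R h
    with trans (sym h) (trans (⊨-lit K k counter) (proj₂ (fits (∈-++⁺ʳ L l∈R)) l∈R))
  ... | ()

  fails⇒⊢ : ∀ {l h} → Γ ⊢* L → Fails l h → Settles Γ (litF l) h → Γ ⊢ ⋁′ R
  fails⇒⊢ ⊢L (inj₁ (l∈L , refl)) s = s (⊢L l∈L)
  fails⇒⊢ ⊢L (inj₂ (l∈R , refl)) s = ⋁′-intro l∈R s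

  middle⇒⊢ : ∀ {k} → Γ ⊢* L → Γ ⊢ ¬′ ∘′ var k → MiddleFails k → Γ ⊢ ⋁′ R
  middle⇒⊢ ⊢L u (inj₁ e)                      = fails⇒⊢ ⊢L e λ c → contra c u
  middle⇒⊢ ⊢L u (inj₂ (inj₁ e))               = fails⇒⊢ ⊢L e u
  middle⇒⊢ ⊢L u (inj₂ (inj₂ (_ , l∈L , l∈R))) = ⋁′-intro l∈R (⊢L l∈L)

  refuted⇒⊢ : ∀ {k} → Refuted k → Γ ⊢* L → Γ ⊢ ⋁′ R
  refuted⇒⊢ {k = k} (refuted (K , eT) (K′ , eF) eM) ⊢L = trichotomy (var k)
    (λ w t → fails⇒⊢ (⊢*-lift w ⊢L) eT (settledᵀ (∧E₁ t) (∧E₂ t) K))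
    (λ w f → fails⇒⊢ (⊢*-lift w ⊢L) eF (settledᶠ (∧E₁ f) (∧E₂ f) K′))
    (λ w u → middle⇒⊢ (⊢*-lift w ⊢L) u eM)

  completeness : (∀ v → v ⊨* L → ∃ λ l → l ∈ R × v ⊨ litF l) → Γ ⊢* L → Γ ⊢ ⋁′ R
  completeness valid ⊢L with search (L ++ R)
  ... | inj₁ (_ , r) = refuted⇒⊢ r ⊢L
  ... | inj₂ fits with valid counter (counter⊨L fits)
  ...   | _ , l∈R , h = contradiction h (counter⊭R fits l∈R)

-- Normal forms

record NormalForm (X : Formula) : Set₁ where
  field
    dnf cnf   : List (List Lit)
    dnf-elim  : ∀ {Γ C} → Γ ⊢ X → (∀ {L} → L ∈ dnf → ∀ {Δ} → Γ ⇛ Δ → Δ ⊢* L → Δ ⊢ C) → Γ ⊢ C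
    dnf-intro : ∀ {L Γ} → L ∈ dnf → Γ ⊢* L → Γ ⊢ X
    -- The side disjunct Z is what lets cnf-intro compose under ∨.
    cnf-intro : ∀ {Γ Z} → (∀ {R} → R ∈ cnf → Γ ⊢ ⋁′ R ∨′ Z) → Γ ⊢ X ∨′ Z
    cnf-elim  : ∀ {R Γ} → R ∈ cnf → Γ ⊢ X → Γ ⊢ ⋁′ R
open NormalForm

_⊗_ : List (List Lit) → List (List Lit) → List (List Lit)
_⊗_ = cartesianProductWith _++_

nf-lit : ∀ l → NormalForm (litF l)
dnf       (nf-lit l) = (l ∷ []) ∷ []
cnf       (nf-lit l) = (l ∷ []) ∷ []
dnf-elim  (nf-lit l) d k = k (here refl) (λ e → e) λ { (here refl) → d }
dnf-intro (nf-lit l) (here refl) ⊢L = ⊢L (here refl)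
cnf-intro (nf-lit l) f = ∨-mapˡ ∨⊥-elim (f (here refl))
cnf-elim  (nf-lit l) (here refl) d = ∨I₁ d

nf-true : (∀ {Γ} → Γ ⊢ X) → NormalForm X
dnf       (nf-true ⊢X) = [] ∷ []
cnf       (nf-true ⊢X) = []
dnf-elim  (nf-true ⊢X) _ k = k (here refl) (λ e → e) λ ()
dnf-intro (nf-true ⊢X) _ _ = ⊢X
cnf-intro (nf-true ⊢X) _ = ∨I₁ ⊢X
cnf-elim  (nf-true ⊢X) ()

nf-false : (∀ {Γ C} → Γ ⊢ X → Γ ⊢ C) → NormalForm X
dnf       (nf-false X⊢) = []
cnf       (nf-false X⊢) = [] ∷ []
dnf-elim  (nf-false X⊢) d _ = X⊢ d
dnf-intro (nf-false X⊢) ()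
cnf-intro (nf-false X⊢) f = ∨-mapˡ ⊥def-elim (f (here refl))
cnf-elim  (nf-false X⊢) (here refl) = X⊢

nf-∧ : NormalForm X → NormalForm Y → NormalForm (X ∧′ Y)
dnf       (nf-∧ nX nY) = dnf nX ⊗ dnf nY
cnf       (nf-∧ nX nY) = cnf nX ++ cnf nY
dnf-elim  (nf-∧ nX nY) d k = dnf-elim nX (∧E₁ d) λ L∈ w ⊢L → dnf-elim nY (w (∧E₂ d)) λ M∈ w′ ⊢M →
  k (∈-cartesianProductWith⁺ _++_ L∈ M∈) (⇛-trans w w′) (⊢*-++ (⊢*-lift w′ ⊢L) ⊢M)
dnf-intro (nf-∧ nX nY) N∈ ⊢N with ∈-cartesianProductWith⁻ _++_ (dnf nX) (dnf nY) N∈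
... | L , M , L∈ , M∈ , refl =
  ∧I (dnf-intro nX L∈ λ l∈ → ⊢N (∈-++⁺ˡ l∈)) (dnf-intro nY M∈ λ l∈ → ⊢N (∈-++⁺ʳ L l∈))
cnf-intro (nf-∧ nX nY) f =
  ∧-∨-distrib (cnf-intro nX λ R∈ → f (∈-++⁺ˡ R∈)) (cnf-intro nY λ R∈ → f (∈-++⁺ʳ (cnf nX) R∈))
cnf-elim  (nf-∧ nX nY) R∈ d with ∈-++⁻ (cnf nX) R∈
... | inj₁ R∈X = cnf-elim nX R∈X (∧E₁ d)
... | inj₂ R∈Y = cnf-elim nY R∈Y (∧E₂ d)

nf-∨ : NormalForm X → NormalForm Y → NormalForm (X ∨′ Y)
dnf       (nf-∨ nX nY) = dnf nX ++ dnf nY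
cnf       (nf-∨ nX nY) = cnf nX ⊗ cnf nY
dnf-elim  (nf-∨ nX nY) d k = cases d
  (λ w x → dnf-elim nX x λ L∈ w′ → k (∈-++⁺ˡ L∈) (⇛-trans w w′))
  (λ w y → dnf-elim nY y λ L∈ w′ → k (∈-++⁺ʳ (dnf nX) L∈) (⇛-trans w w′))
dnf-intro (nf-∨ nX nY) L∈ ⊢L with ∈-++⁻ (dnf nX) L∈
... | inj₁ L∈X = ∨I₁ (dnf-intro nX L∈X ⊢L)
... | inj₂ L∈Y = ∨I₂ (dnf-intro nY L∈Y ⊢L)
cnf-intro (nf-∨ nX nY) f = ∨-assocˡ (cnf-intro nX λ {R} R∈ → ∨-exchange (cnf-intro nY λ S∈ →
  ∨-exchange (∨-assocʳ (∨-mapˡ (⋁′-++⁻ R) (f (∈-cartesianProductWith⁺ _++_ R∈ S∈))))))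
cnf-elim  (nf-∨ nX nY) RS∈ d with ∈-cartesianProductWith⁻ _++_ (cnf nX) (cnf nY) RS∈
... | R , S , R∈ , S∈ , refl =
  cases d (λ _ x → ⋁′-++⁺ˡ (cnf-elim nX R∈ x)) (λ _ y → ⋁′-++⁺ʳ R (cnf-elim nY S∈ y))

infix 2 _⊣⊢_
_⊣⊢_ : Formula → Formula → Set₁
X ⊣⊢ Y = ∀ {Γ} → (Γ ⊢ X) ⇔ (Γ ⊢ Y)

nf-⊣⊢ : X ⊣⊢ Y → NormalForm Y → NormalForm X
dnf       (nf-⊣⊢ X⊣⊢Y nY) = dnf nY
cnf       (nf-⊣⊢ X⊣⊢Y nY) = cnf nY
dnf-elim  (nf-⊣⊢ X⊣⊢Y nY) d = dnf-elim nY (Equivalence.to X⊣⊢Y d)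
dnf-intro (nf-⊣⊢ X⊣⊢Y nY) L∈ ⊢L = Equivalence.from X⊣⊢Y (dnf-intro nY L∈ ⊢L)
cnf-intro (nf-⊣⊢ X⊣⊢Y nY) f = ∨-mapˡ (Equivalence.from X⊣⊢Y) (cnf-intro nY f)
cnf-elim  (nf-⊣⊢ X⊣⊢Y nY) R∈ d = cnf-elim nY R∈ (Equivalence.to X⊣⊢Y d)

¬-∧ : ¬′ (A ∧′ B) ⊣⊢ ¬′ A ∨′ ¬′ B
¬-∧ = mk⇔ (λ d → ¬∧E d (∨I₁ (hyp (inj₂ refl))) (∨I₂ (hyp (inj₂ refl))))
          (λ d → cases d (λ _ → ¬∧I₁) (λ _ → ¬∧I₂))

¬-∨ : ¬′ (A ∨′ B) ⊣⊢ ¬′ A ∧′ ¬′ B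
¬-∨ = mk⇔ (λ d → ∧I (¬∨E₁ d) (¬∨E₂ d)) (λ d → ¬∨I (∧E₁ d) (∧E₂ d))

¬¬ : ¬′ ¬′ A ⊣⊢ A
¬¬ = mk⇔ DNE DNI

∘-ᵀᶠ : ∘′ A ⊣⊢ A ᵀ ∨′ A ᶠ
∘-ᵀᶠ = mk⇔ (λ c → cases (PEM∘ c) (λ w a → ∨I₁ (∧I (w c) a)) (λ w a → ∨I₂ (∧I (w c) a)))
           (λ d → cases d (λ _ → ∧E₁) (λ _ → ∧E₁))

ᵀ-∧ : (A ∧′ B) ᵀ ⊣⊢ A ᵀ ∧′ B ᵀ
ᵀ-∧ = mk⇔ (λ d → ∧I (E∧T₁ d) (E∧T₂ d)) (λ d → I∧T (∧E₁ d) (∧E₂ d))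

ᵀ-∨ : (A ∨′ B) ᵀ ⊣⊢ A ᵀ ∨′ B ᵀ
ᵀ-∨ = mk⇔ (λ d → E∨T d (∨I₁ (hyp (inj₂ refl))) (∨I₂ (hyp (inj₂ refl))))
          (λ d → cases d (λ _ → I∨T₁) (λ _ → I∨T₂))

ᵀ-¬ : (¬′ A) ᵀ ⊣⊢ A ᶠ
ᵀ-¬ = mk⇔ (λ d → ∧I (E¬∘ (∧E₁ d)) (∧E₂ d)) (λ d → ∧I (I¬∘ (∧E₁ d)) (∧E₂ d))

ᵀ-∘ : (∘′ A) ᵀ ⊣⊢ ∘′ A
ᵀ-∘ = mk⇔ ∧E₂ (∧I I∘)

ᶠ-∧ : (A ∧′ B) ᶠ ⊣⊢ A ᶠ ∨′ B ᶠ
ᶠ-∧ = mk⇔ (λ d → E∧F d (∨I₁ (hyp (inj₂ refl))) (∨I₂ (hyp (inj₂ refl))))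
          (λ d → cases d (λ _ → I∧F₁) (λ _ → I∧F₂))

ᶠ-∨ : (A ∨′ B) ᶠ ⊣⊢ A ᶠ ∧′ B ᶠ
ᶠ-∨ = mk⇔ (λ d → ∧I (E∨F₁ d) (E∨F₂ d)) (λ d → I∨F (∧E₁ d) (∧E₂ d))

ᶠ-¬ : (¬′ A) ᶠ ⊣⊢ A ᵀ
ᶠ-¬ = mk⇔ (λ d → ∧I (E¬∘ (∧E₁ d)) (DNE (∧E₂ d))) (λ d → ∧I (I¬∘ (∧E₁ d)) (DNI (∧E₂ d)))

ᶠ-∘ : (∘′ A) ᶠ ⊣⊢ ¬′ ∘′ A
ᶠ-∘ = mk⇔ ∧E₂ (∧I I∘)

¬∘-¬ : ¬′ ∘′ ¬′ A ⊣⊢ ¬′ ∘′ A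
¬∘-¬ = mk⇔
  (λ u → ¬∘-intro (λ w t → ᶠ-¬∘-conflict (Equivalence.from ᶠ-¬ t) (w u))
                  (λ w f → ᵀ-¬∘-conflict (Equivalence.from ᵀ-¬ f) (w u)))
  (λ u → ¬∘-intro (λ w t → ᶠ-¬∘-conflict (Equivalence.to ᵀ-¬ t) (w u))
                  (λ w f → ᵀ-¬∘-conflict (Equivalence.to ᶠ-¬ f) (w u)))

¬∘-∧ : ¬′ ∘′ (A ∧′ B) ⊣⊢ (¬′ ∘′ A ∧′ ¬′ ∘′ B) ∨′ (¬′ ∘′ A ∧′ B ᵀ) ∨′ (A ᵀ ∧′ ¬′ ∘′ B)
¬∘-∧ {A} {B} = mk⇔
  (λ u → trichotomy A
    (λ w a → trichotomy B
      (λ w′ b → ᵀ-¬∘-conflict (I∧T (w′ a) b) (w′ (w u)))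
      (λ w′ b → ᶠ-¬∘-conflict (I∧F₂ b) (w′ (w u)))
      (λ w′ b → ∨I₂ (∨I₂ (∧I (w′ a) b))))
    (λ w a → ᶠ-¬∘-conflict (I∧F₁ a) (w u))
    (λ w a → trichotomy B
      (λ w′ b → ∨I₂ (∨I₁ (∧I (w′ a) b)))
      (λ w′ b → ᶠ-¬∘-conflict (I∧F₂ b) (w′ (w u)))
      (λ w′ b → ∨I₁ (∧I (w′ a) b))))
  (λ d → ¬∘-intro
    (λ w t → cases₃ (w d)
      (λ w′ e → ᵀ-¬∘-conflict (w′ (E∧T₁ t)) (∧E₁ e))
      (λ w′ e → ᵀ-¬∘-conflict (w′ (E∧T₁ t)) (∧E₁ e))
      (λ w′ e → ᵀ-¬∘-conflict (w′ (E∧T₂ t)) (∧E₂ e)))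
    (λ w f → cases (Equivalence.to ᶠ-∧ f)
      (λ w′ a → cases₃ (w′ (w d))
        (λ w″ e → ᶠ-¬∘-conflict (w″ a) (∧E₁ e))
        (λ w″ e → ᶠ-¬∘-conflict (w″ a) (∧E₁ e))
        (λ w″ e → ᵀ-ᶠ-conflict (∧E₁ e) (w″ a)))
      (λ w′ b → cases₃ (w′ (w d))
        (λ w″ e → ᶠ-¬∘-conflict (w″ b) (∧E₂ e))
        (λ w″ e → ᵀ-ᶠ-conflict (∧E₂ e) (w″ b))
        (λ w″ e → ᶠ-¬∘-conflict (w″ b) (∧E₂ e)))))

¬∘-∨ : ¬′ ∘′ (A ∨′ B) ⊣⊢ (¬′ ∘′ A ∧′ ¬′ ∘′ B) ∨′ (¬′ ∘′ A ∧′ B ᶠ) ∨′ (A ᶠ ∧′ ¬′ ∘′ B)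
¬∘-∨ {A} {B} = mk⇔
  (λ u → trichotomy A
    (λ w a → ᵀ-¬∘-conflict (I∨T₁ a) (w u))
    (λ w a → trichotomy B
      (λ w′ b → ᵀ-¬∘-conflict (I∨T₂ b) (w′ (w u)))
      (λ w′ b → ᶠ-¬∘-conflict (I∨F (w′ a) b) (w′ (w u)))
      (λ w′ b → ∨I₂ (∨I₂ (∧I (w′ a) b))))
    (λ w a → trichotomy B
      (λ w′ b → ᵀ-¬∘-conflict (I∨T₂ b) (w′ (w u)))
      (λ w′ b → ∨I₂ (∨I₁ (∧I (w′ a) b)))
      (λ w′ b → ∨I₁ (∧I (w′ a) b))))
  (λ d → ¬∘-intro
    (λ w t → cases (Equivalence.to ᵀ-∨ t)
      (λ w′ a → cases₃ (w′ (w d))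
        (λ w″ e → ᵀ-¬∘-conflict (w″ a) (∧E₁ e))
        (λ w″ e → ᵀ-¬∘-conflict (w″ a) (∧E₁ e))
        (λ w″ e → ᵀ-ᶠ-conflict (w″ a) (∧E₁ e)))
      (λ w′ b → cases₃ (w′ (w d))
        (λ w″ e → ᵀ-¬∘-conflict (w″ b) (∧E₂ e))
        (λ w″ e → ᵀ-ᶠ-conflict (w″ b) (∧E₂ e))
        (λ w″ e → ᵀ-¬∘-conflict (w″ b) (∧E₂ e))))
    (λ w f → cases₃ (w d)
      (λ w′ e → ᶠ-¬∘-conflict (w′ (E∨F₁ f)) (∧E₁ e))
      (λ w′ e → ᶠ-¬∘-conflict (w′ (E∨F₁ f)) (∧E₁ e))
      (λ w′ e → ᶠ-¬∘-conflict (w′ (E∨F₂ f)) (∧E₂ e))))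

nf∘ : ∀ A → NormalForm (∘′ unfold A)
nfP : ∀ A → NormalForm (unfold A)
nfN : ∀ A → NormalForm (¬′ unfold A)
nfT : ∀ A → NormalForm (unfold A ᵀ)
nfF : ∀ A → NormalForm (unfold A ᶠ)
nfU : ∀ A → NormalForm (¬′ ∘′ unfold A)

nf∘ A = nf-⊣⊢ ∘-ᵀᶠ (nf-∨ (nfT A) (nfF A))

nfP (var k)  = nf-lit (pos , k)
nfP (A ∧′ B) = nf-∧ (nfP A) (nfP B)
nfP (A ∨′ B) = nf-∨ (nfP A) (nfP B)
nfP (¬′ A)   = nfN A
nfP (∘′ A)   = nf∘ A
nfP ⊥′       = nf-false ⊥def-elim
nfP ⊤′       = nf-true ⊢⊤

nfN (var k)  = nf-lit (neg , k)
nfN (A ∧′ B) = nf-⊣⊢ ¬-∧ (nf-∨ (nfN A) (nfN B))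
nfN (A ∨′ B) = nf-⊣⊢ ¬-∨ (nf-∧ (nfN A) (nfN B))
nfN (¬′ A)   = nf-⊣⊢ ¬¬ (nfP A)
nfN (∘′ A)   = nfU A
nfN ⊥′       = nf-true (DNI ⊢⊤)
nfN ⊤′       = nf-false ⊥def-elim

nfT (var k)  = nf-∧ (nf-lit (circ , k)) (nf-lit (pos , k))
nfT (A ∧′ B) = nf-⊣⊢ ᵀ-∧ (nf-∧ (nfT A) (nfT B))
nfT (A ∨′ B) = nf-⊣⊢ ᵀ-∨ (nf-∨ (nfT A) (nfT B))
nfT (¬′ A)   = nf-⊣⊢ ᵀ-¬ (nfF A)
nfT (∘′ A)   = nf-⊣⊢ ᵀ-∘ (nf∘ A)
nfT ⊥′       = nf-false λ d → ⊥def-elim (∧E₂ d)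
nfT ⊤′       = nf-true ⊢⊤ᵀ

nfF (var k)  = nf-∧ (nf-lit (circ , k)) (nf-lit (neg , k))
nfF (A ∧′ B) = nf-⊣⊢ ᶠ-∧ (nf-∨ (nfF A) (nfF B))
nfF (A ∨′ B) = nf-⊣⊢ ᶠ-∨ (nf-∧ (nfF A) (nfF B))
nfF (¬′ A)   = nf-⊣⊢ ᶠ-¬ (nfT A)
nfF (∘′ A)   = nf-⊣⊢ ᶠ-∘ (nfU A)
nfF ⊥′       = nf-true (∧I (I¬∘ (∧E₁ ⊢⊤ᵀ)) (DNI ⊢⊤))
nfF ⊤′       = nf-false λ d → ⊥def-elim (∧E₂ d)

nfU (var k)  = nf-lit (ncirc , k)
nfU (A ∧′ B) = nf-⊣⊢ ¬∘-∧
  (nf-∨ (nf-∧ (nfU A) (nfU B)) (nf-∨ (nf-∧ (nfU A) (nfT B)) (nf-∧ (nfT A) (nfU B))))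
nfU (A ∨′ B) = nf-⊣⊢ ¬∘-∨
  (nf-∨ (nf-∧ (nfU A) (nfU B)) (nf-∨ (nf-∧ (nfU A) (nfF B)) (nf-∧ (nfF A) (nfU B))))
nfU (¬′ A)   = nf-⊣⊢ ¬∘-¬ (nfU A)
nfU (∘′ A)   = nf-false (contra I∘)
nfU ⊥′       = nf-false (contra (I¬∘ (∧E₁ ⊢⊤ᵀ)))
nfU ⊤′       = nf-false (contra (∧E₁ ⊢⊤ᵀ))

-- Completeness

dnf-sound : ∀ {L v} (nX : NormalForm X) → L ∈ dnf nX → v ⊨* L → v ⊨ X
dnf-sound {L = L} nX L∈ v⊨L =
  ⊢-preserves-⊨ (dnf-intro nX {Γ = _∈ map litF L} L∈ λ l∈ → hyp (∈-map⁺ litF l∈)) v⊨lits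
  where
  v⊨lits : ∀ {H} → H ∈ map litF L → _ ⊨ H
  v⊨lits H∈ with ∈-map⁻ litF H∈
  ... | _ , l∈ , refl = v⊨L l∈

cnf-sound : ∀ {R v} (nX : NormalForm X) → R ∈ cnf nX → v ⊨ X → v ⊨ ⋁′ R
cnf-sound {X = X} nX R∈ v⊨X = ⊢-preserves-⊨ (cnf-elim nX {Γ = _≡ X} R∈ (hyp refl)) λ { refl → v⊨X }

complete : NormalForm X → NormalForm Y → (∀ v → ⟦ X ⟧ v ≤S ⟦ Y ⟧ v) → Γ ⊢ X → Γ ⊢ Y
complete nX nY X≤Y d = dnf-elim nX d λ {L} L∈ _ ⊢L → ∨⊥-elim (cnf-intro nY λ {R} R∈ →
  ∨I₁ (Atomic.completeness L R
         (λ v v⊨L → ⊨⋁′ R (cnf-sound nY R∈ (↑n-mono (X≤Y v) (dnf-sound nX L∈ v⊨L))))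
         ⊢L))

unfold-sem : ∀ A v → ⟦ unfold A ⟧ v ≡ ⟦ A ⟧ v
unfold-sem (var k)  v = refl
unfold-sem (A ∧′ B) v = cong₂ _⊓_ (unfold-sem A v) (unfold-sem B v)
unfold-sem (A ∨′ B) v = cong₂ _⊔_ (unfold-sem A v) (unfold-sem B v)
unfold-sem (¬′ A)   v = cong ∼_ (unfold-sem A v)
unfold-sem (∘′ A)   v = cong ∘S (unfold-sem A v)
unfold-sem ⊥′       v = ⊥def-false v
unfold-sem ⊤′       v = ⊤def-true v

complete-unfold : ∀ X Y → (∀ v → ⟦ X ⟧ v ≤S ⟦ Y ⟧ v) → Γ ⊢ unfold X → Γ ⊢ unfold Y
complete-unfold X Y X≤Y =
  complete (nfP X) (nfP Y) λ v → subst₂ _≤S_ (sym (unfold-sem X v)) (sym (unfold-sem Y v)) (X≤Y v)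

unfold[_] : FSet → FSet
unfold[ Γ ] X = Σ Formula λ B → Γ B × unfold B ≡ X

pullback : ∀ {Hs} → All unfold[ Γ ] Hs → Σ (List Formula) λ Bs → All Γ Bs × map unfold Bs ≡ Hs
pullback [] = [] , [] , refl
pullback ((B , B∈Γ , refl) ∷ Hs∈) with pullback Hs∈
... | Bs , Bs∈Γ , refl = B ∷ Bs , B∈Γ ∷ Bs∈Γ , refl

meet-unfold : ∀ Bs v → meet (map unfold Bs) v ≡ meet Bs v
meet-unfold []       v = refl
meet-unfold (B ∷ Bs) v = cong₂ _⊓_ (unfold-sem B v) (meet-unfold Bs v)

⊢LETF⁺-sound : Γ ⊢LETF⁺ A → Σ (List Formula) λ Bs → All Γ Bs × ∀ v → meet Bs v ≤S ⟦ A ⟧ v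
⊢LETF⁺-sound {A = A} d with soundness d
... | entails Hs Hs∈ bound with pullback Hs∈
...   | Bs , Bs∈Γ , refl = Bs , Bs∈Γ , λ v → subst₂ _≤S_ (meet-unfold Bs v) (unfold-sem A v) (bound v)

meetVals≤meet : ∀ A As v → meetVals A As v ≤S meet (A ∷ As) v
meetVals≤meet A []       v = ⊓-glb (≤-refl (⟦ A ⟧ v)) (≤-top (⟦ A ⟧ v))
meetVals≤meet A (B ∷ Bs) v = ⊓-monoʳ (⟦ A ⟧ v) (meetVals≤meet B Bs v)

conj : Formula → List Formula → Formula
conj A []       = A
conj A (B ∷ Bs) = A ∧′ conj B Bs

⟦conj⟧ : ∀ A As v → ⟦ conj A As ⟧ v ≡ meetVals A As v
⟦conj⟧ A []       v = refl
⟦conj⟧ A (B ∷ Bs) v = cong (⟦ A ⟧ v ⊓_) (⟦conj⟧ B Bs v)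

⊢conj : ∀ {A As} → Γ A → All Γ As → unfold[ Γ ] ⊢ unfold (conj A As)
⊢conj A∈Γ []          = hyp (_ , A∈Γ , refl)
⊢conj A∈Γ (B∈Γ ∷ Bs∈) = ∧I (hyp (_ , A∈Γ , refl)) (⊢conj B∈Γ Bs∈)

proposition5p4 : (Γ : FSet) (A : Formula) → (Γ ⊢LETF⁺ A) ⇔ (Γ ⊨≤ A)
proposition5p4 Γ A = mk⇔ to from
  where
  to : Γ ⊢LETF⁺ A → Γ ⊨≤ A
  to d with ⊢LETF⁺-sound d
  ... | [] , _ , T≤A = inj₁ λ v → T-maximum (T≤A v)
  ... | B ∷ Bs , B∈Γ ∷ Bs∈Γ , meet≤A =
    inj₂ (B , Bs , B∈Γ , Bs∈Γ , λ v → ≤-trans (meetVals≤meet B Bs v) (meet≤A v))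

  from : Γ ⊨≤ A → Γ ⊢LETF⁺ A
  from (inj₁ valid) = complete-unfold ⊤′ A (λ v → subst (T ≤S_) (sym (valid v)) refl) ⊢⊤
  from (inj₂ (A₁ , As , A₁∈Γ , As∈Γ , meetVals≤A)) =
    complete-unfold (conj A₁ As) A (λ v → subst (_≤S ⟦ A ⟧ v) (sym (⟦conj⟧ A₁ As v)) (meetVals≤A v))
      (⊢conj A₁∈Γ As∈Γ)
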